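{- Let $r\geq 2$ be an integer and let $H$ be a graph with no vertices of degree one and girth at least $2r+3$, and let $G=H^r$, with common vertex set $V$. For $v\in V$ let $B_v=N_G(v)\cup\{v\}$ (the set of vertices at distance at most $r$ from $v$ in $H$). For $x,y\in V$ define $$S_{x,y}=\Big(B_x\cap B_y\setminus\bigcup_{v\in B_y\setminus B_x} B_v\Big) \setminus \{x\},\qquad P_{x,y}=B_x\cap B_y\cap\bigcup_{v\in S_{x,y}} B_v,$$ $$N_{x,y}=\Big(B_x\cap B_y\cap\bigcap_{v\in P_{x,y}} B_v\Big) \setminus \{x\}.$$ If $xy$ is an edge of $H$, then $N_{x,y}=N_H(x)$.
   Context: All graphs are simple, undirected and connected. $H^r$ is the graph on $V(H)$ in which two distinct vertices are adjacent iff their distance in $H$ is at most $r$. $N_K(u)$ denotes the set of neighbours of $u$ in a graph $K$. The girth is the length of the shortest cycle. -}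

module Defs where

open import Data.Nat using (ℕ; zero; suc; _≤_; _+_; _*_)
open import Data.Fin using (Fin; inject₁; fromℕ) renaming (zero to fzero; suc to fsuc)
open import Data.Bool using (Bool; true; false; T)
open import Data.List using (length; filter; allFin)
open import Data.Sum using (_⊎_)
open import Data.Product using (Σ; ∃; _×_; _,_)
open import Relation.Binary.PropositionalEquality using (_≡_; _≢_)
open import Relation.Nullary using (¬_)
open import Data.Bool.Properties using (T?)
open import Function.Definitions using (Injective)

record Graph (n : ℕ) : Set where
  field
    adj   : Fin n → Fin n → Bool
    sym   : ∀ u v → adj u v ≡ adj v u
    irrfl : ∀ v → adj v v ≡ false
open Graph public

module _ {n : ℕ} (H : Graph n) where

  Adj : Fin n → Fin n → Set
  Adj u v = T (adj H u v)

  data Walk : Fin n → Fin n → ℕ → Set where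
    here : ∀ {v} → Walk v v 0
    step : ∀ {u w v k} → Adj u w → Walk w v k → Walk u v (suc k)

  DistLe : ℕ → Fin n → Fin n → Set
  DistLe k u v = Σ ℕ λ m → m ≤ k × Walk u v m

  Connected : Set
  Connected = ∀ u v → Σ ℕ λ m → Walk u v m

  degree : Fin n → ℕ
  degree v = length (filter (λ u → T? (adj H v u)) (allFin n))

  -- a cycle of length suc k (k ≥ 2): distinct vertices c 0, …, c k,
  -- consecutive ones adjacent and c k adjacent to c 0
  IsCycle : (k : ℕ) → (Fin (suc k) → Fin n) → Set
  IsCycle k c = (2 ≤ k)
              × Injective _≡_ _≡_ c
              × (∀ (i : Fin k) → Adj (c (inject₁ i)) (c (fsuc i)))
              × Adj (c (fromℕ k)) (c fzero)

  GirthAtLeast : ℕ → Set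
  GirthAtLeast g = ∀ k c → IsCycle k c → g ≤ suc k

module Construction {n : ℕ} (H : Graph n) (r : ℕ) where

  AdjG : Fin n → Fin n → Set
  AdjG u v = u ≢ v × DistLe H r u v

  -- z ∈ B_v = N_G(v) ∪ {v}
  B : Fin n → Fin n → Set
  B v z = AdjG v z ⊎ z ≡ v

  S : Fin n → Fin n → Fin n → Set
  S x y z = (B x z × B y z × ¬ (∃ λ v → B y v × ¬ B x v × B v z)) × z ≢ x

  P : Fin n → Fin n → Fin n → Set
  P x y z = B x z × B y z × (∃ λ v → S x y v × B v z)

  N : Fin n → Fin n → Fin n → Set
  N x y z = (B x z × B y z × (∀ v → P x y v → B v z)) × z ≢ x

module Submission where

-- Up to distance r+1, H then looks like a tree; precisely, the
-- proof rests on two facts about trails (walks that never immediately turn back):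
--   * two trails between the same vertices whose lengths add up to less than the
--     girth coincide, so a trail of length r+1 joins vertices at distance > r;
--   * since degrees are at least two, a trail can always be continued, and it
--     can be made to follow any given trail for as long as that one lasts.  For the theorem: a neighbour w ≠ y
-- of x lies in S_{x,y}, so every vertex within r-1 of x lies in P_{x,y}; a member
-- z of N_{x,y} at distance ≥ 2 from x is pushed out of such a ball by a trail of
-- length r+1.  Conversely a neighbour z of x can only miss some B_v with v ∈ P_{x,y}
-- when v is at distance r from x behind y; then any s ∈ S_{x,y} with v ∈ B_s would
-- see a vertex of B_y \ B_x, found by leaving the trail v → y → x where a shortest
-- trail v → s branches off and walking r+1 steps away from x.

open import Defs
open import Data.Nat using (ℕ; zero; suc; _≤_; _<_; _+_; _*_; _∸_; z≤n; s≤s)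
open import Data.Nat.Properties
open import Data.Nat.Tactic.RingSolver using (solve-∀)
open import Data.Fin using (Fin; inject₁; fromℕ) renaming (zero to fzero; suc to fsuc)
open import Data.Fin.Properties using (any?) renaming (_≟_ to _≟ᶠ_)
open import Data.List using (List; []; _∷_; _++_; _∷ʳ_; [_]; length; filter; allFin; lookup)
open import Data.List.Properties using (length-++; ∷-injectiveˡ; filter-accept; filter-reject; filter-none)
open import Data.List.Relation.Unary.All as All using ([]; _∷_)
open import Data.List.Relation.Unary.All.Properties using (All¬⇒¬Any; ¬Any⇒All¬; ++⁻)
open import Data.List.Relation.Unary.AllPairs using ([]; _∷_)
open import Data.List.Relation.Unary.Any using (here; there)
open import Data.List.Relation.Unary.Unique.Propositional using (Unique)
open import Data.List.Relation.Unary.Unique.Propositional.Properties using (allFin⁺)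
open import Data.List.Membership.Propositional using (_∈_)
open import Data.List.Membership.Propositional.Properties using (∈-∃++; ∈-allFin; ∈-lookup)
open import Data.Bool using (T)
open import Data.Bool.Properties using (T?)
open import Data.Unit using (⊤; tt)
open import Data.Empty using (⊥; ⊥-elim)
open import Data.Sum using (inj₁; inj₂)
open import Data.Product using (Σ; ∃; _×_; _,_; proj₁; proj₂)
open import Relation.Binary.PropositionalEquality as ≡ using (_≡_; _≢_; refl; cong; subst; trans; ≢-sym)
open import Relation.Nullary using (¬_; Dec; yes; no)
open import Relation.Nullary.Decidable using (_×-dec_; ¬?; decidable-stable)
open import Function.Bundles using (_⇔_; mk⇔)

module Walks {n : ℕ} (H : Graph n) where

  private
    V : Set
    V = Fin n

  adj-sym : ∀ {u v} → Adj H u v → Adj H v u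
  adj-sym {u} {v} = subst T (sym H u v)

  adj-irrefl : ∀ {u v} → Adj H u v → u ≢ v
  adj-irrefl {u} uv refl = subst T (irrfl H u) uv

  _++ʷ_ : ∀ {a b c k m} → Walk H a b k → Walk H b c m → Walk H a c (k + m)
  here        ++ʷ walk′ = walk′
  step e walk ++ʷ walk′ = step e (walk ++ʷ walk′)

  reverseʷ : ∀ {a b k} → Walk H a b k → Walk H b a k
  reverseʷ here = here
  reverseʷ {k = suc k} (step e walk) =
    subst (Walk H _ _) (+-comm k 1) (reverseʷ walk ++ʷ step (adj-sym e) here)

  dist-edge : ∀ {a b} → Adj H a b → DistLe H 1 a b
  dist-edge e = 1 , ≤-refl , step e here

  dist-mono : ∀ {k k′ a b} → k ≤ k′ → DistLe H k a b → DistLe H k′ a b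
  dist-mono k≤k′ (m , m≤k , walk) = m , ≤-trans m≤k k≤k′ , walk

  dist-sym : ∀ {k a b} → DistLe H k a b → DistLe H k b a
  dist-sym (m , m≤k , walk) = m , m≤k , reverseʷ walk

  dist-trans : ∀ {k m a b c} → DistLe H k a b → DistLe H m b c → DistLe H (k + m) a c
  dist-trans (i , i≤k , walk) (j , j≤m , walk′) = i + j , +-mono-≤ i≤k j≤m , walk ++ʷ walk′

  Fresh : V → List V → Set
  Fresh a []      = ⊤
  Fresh a (c ∷ _) = a ≢ c

  data FreshView (a : V) : List V → Set where
    fresh : ∀ {l} → Fresh a l → FreshView a l
    same  : ∀ l → FreshView a (a ∷ l)

  freshView : ∀ a l → FreshView a l
  freshView a []      = fresh tt
  freshView a (c ∷ l) with a ≟ᶠ c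
  ... | yes refl = same l
  ... | no a≢c   = fresh a≢c

  -- Trail a b l: a non-backtracking walk from a to b visiting the vertices l
  -- after a; consecutive vertices are adjacent and no step returns at once.
  data Trail : V → V → List V → Set where
    stop : ∀ {a} → Trail a a []
    go   : ∀ {a b c l} → Adj H a b → Fresh a l → Trail b c l → Trail a c (b ∷ l)

  trail-tail : ∀ {a b c l} → Trail a c (b ∷ l) → Trail b c l
  trail-tail (go _ _ t) = t

  trail-dist : ∀ {a b l} → Trail a b l → DistLe H (length l) a b
  trail-dist t = _ , ≤-refl , walk t
    where
    walk : ∀ {a b l} → Trail a b l → Walk H a b (length l)
    walk stop       = here
    walk (go e _ t) = step e (walk t)

  walk-to-trail : ∀ {a b m} → Walk H a b m → Σ (List V) λ l → Trail a b l × length l ≤ m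
  walk-to-trail here = [] , stop , z≤n
  walk-to-trail {a} (step {w = w} e walk) with walk-to-trail walk
  ... | l , t , l≤m with freshView a l
  ...   | fresh f = w ∷ l , go e f t , s≤s l≤m
  ...   | same l′ = l′ , trail-tail t , ≤-trans (n≤1+n _) (m≤n⇒m≤1+n l≤m)

  geodesic : ∀ {k a b} → DistLe H k a b → Σ (List V) λ l → Trail a b l × length l ≤ k
  geodesic (m , m≤k , walk) with walk-to-trail walk
  ... | l , t , l≤m = l , t , ≤-trans l≤m m≤k

  -- Gluing: two trails leaving a in different directions combine into a trail
  -- from the end of the first (run backwards) to the end of the second.
  flipOnto : V → List V → List V → List V
  flipOnto a []       ys = ys
  flipOnto a (b ∷ xs) ys = flipOnto b xs (a ∷ ys)

  Apart : List V → List V → Set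
  Apart []      _  = ⊤
  Apart (b ∷ _) ys = Fresh b ys

  apart-nil : ∀ xs → Apart xs []
  apart-nil []      = tt
  apart-nil (_ ∷ _) = tt

  apart-cons : ∀ {a} xs {ys} → Fresh a xs → Apart xs (a ∷ ys)
  apart-cons []      _   = tt
  apart-cons (_ ∷ _) a≢c = ≢-sym a≢c

  glue : ∀ {a b c xs ys} → Trail a b xs → Trail a c ys → Apart xs ys → Trail b c (flipOnto a xs ys)
  glue stop                t′ _  = t′
  glue (go {l = xs} e f t) t′ ap = glue t (go (adj-sym e) ap t′) (apart-cons xs f)

  length-flipOnto : ∀ a xs ys → length (flipOnto a xs ys) ≡ length xs + length ys
  length-flipOnto a []       ys = refl
  length-flipOnto a (b ∷ xs) ys = trans (length-flipOnto b xs (a ∷ ys)) (+-suc (length xs) (length ys))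

  flipOnto-empty : ∀ a xs ys → flipOnto a xs ys ≡ [] → xs ≡ [] × ys ≡ []
  flipOnto-empty a []       ys eq = refl , eq
  flipOnto-empty a (b ∷ xs) ys eq with flipOnto-empty b xs (a ∷ ys) eq
  ... | _ , ()

  flipOnto-++ : ∀ a xs ys zs → flipOnto a xs (ys ++ zs) ≡ flipOnto a xs ys ++ zs
  flipOnto-++ a []       ys zs = refl
  flipOnto-++ a (b ∷ xs) ys zs = flipOnto-++ b xs (a ∷ ys) zs

  split : ∀ {a b} xs {ys} → Trail a b (xs ++ ys) → Σ V λ c → Trail a c xs × Trail c b ys
  split []       t          = _ , stop , t
  split (_ ∷ xs) (go e f t) with split xs t
  ... | c , t₁ , t₂ = c , go e (fresh-prefix xs f) t₁ , t₂
    where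
    fresh-prefix : ∀ {a} xs {ys} → Fresh a (xs ++ ys) → Fresh a xs
    fresh-prefix []      _ = tt
    fresh-prefix (_ ∷ _) f = f

  end-∈ : ∀ {a b c l} → Trail a b (c ∷ l) → b ∈ c ∷ l
  end-∈ (go _ _ stop)          = here refl
  end-∈ (go _ _ t@(go _ _ _)) = there (end-∈ t)

  lookup-adjacent : ∀ {a b l} → Trail a b l → (i : Fin (length l)) →
                    Adj H (lookup (a ∷ l) (inject₁ i)) (lookup (a ∷ l) (fsuc i))
  lookup-adjacent (go e _ _) fzero    = e
  lookup-adjacent (go _ _ t) (fsuc i) = lookup-adjacent t i

  lookup-end : ∀ {a b l} → Trail a b l → lookup (a ∷ l) (fromℕ (length l)) ≡ b
  lookup-end stop       = refl
  lookup-end (go _ _ t) = lookup-end t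

  lookup-injective : ∀ {l : List V} → Unique l → ∀ {i j} → lookup l i ≡ lookup l j → i ≡ j
  lookup-injective {_ ∷ _} _            {fzero}  {fzero}  _  = refl
  lookup-injective {_ ∷ l} (c∉l ∷ _)   {fzero}  {fsuc j} eq = ⊥-elim (All¬⇒¬Any c∉l (subst (_∈ l) (≡.sym eq) (∈-lookup j)))
  lookup-injective {_ ∷ l} (c∉l ∷ _)   {fsuc i} {fzero}  eq = ⊥-elim (All¬⇒¬Any c∉l (subst (_∈ l) eq (∈-lookup i)))
  lookup-injective {_ ∷ _} (_ ∷ uniq) {fsuc i} {fsuc j} eq = cong fsuc (lookup-injective uniq eq)

  unique-prefix : ∀ {a : V} xs {ys : List V} → Unique (xs ++ a ∷ ys) → Unique (a ∷ xs)
  unique-prefix []       _            = [] ∷ []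
  unique-prefix (c ∷ xs) (c∉ ∷ uniq) with unique-prefix xs uniq | ++⁻ xs c∉
  ... | a∉xs ∷ uniq′ | c∉xs , c≢a ∷ _ = (≢-sym c≢a ∷ a∉xs) ∷ (c∉xs ∷ uniq′)

  module Girth (g : ℕ) (girth : GirthAtLeast H g) where

    -- A trail returning to its start a after visiting distinct vertices closes
    -- a cycle, hence is at least as long as the girth.
    return-length : ∀ {a b} xs {ys} → Trail a b (xs ++ a ∷ ys) → Unique (a ∷ xs) → g ≤ suc (length xs)
    return-length []          (go e _ _) _ = ⊥-elim (adj-irrefl e refl)
    return-length (_ ∷ [])    (go _ f _) _ = ⊥-elim (f refl)
    return-length {a} xs@(_ ∷ _ ∷ _) t uniq with split xs t
    ... | c , t₁ , go ca _ _ =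
      girth (length xs) (lookup (a ∷ xs))
        ( s≤s (s≤s z≤n)
        , lookup-injective uniq
        , lookup-adjacent t₁
        , subst (λ v → Adj H v a) (≡.sym (lookup-end t₁)) ca )

    short-trail-is-path : ∀ {a b l} → Trail a b l → length l < g → Unique (a ∷ l)
    short-trail-is-path stop _ = [] ∷ []
    short-trail-is-path {a} {b} {l} t@(go _ _ t′) l<g = ¬Any⇒All¬ l a∉l ∷ uniq
      where
      uniq : Unique l
      uniq = short-trail-is-path t′ (≤-trans (n≤1+n _) l<g)
      a∉l : ¬ (a ∈ l)
      a∉l a∈l with ∈-∃++ a∈l
      ... | xs , ys , l≡ = <⇒≱ l<g (begin
        g                              ≤⟨ return-length xs (subst (Trail a b) l≡ t) (unique-prefix xs (subst Unique l≡ uniq)) ⟩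
        suc (length xs)                ≤⟨ s≤s (m≤m+n (length xs) (length ys)) ⟩
        suc (length xs + length ys)    ≡⟨ +-suc (length xs) (length ys) ⟨
        length xs + length (a ∷ ys)    ≡⟨ length-++ xs ⟨
        length (xs ++ a ∷ ys)          ≡⟨ cong length l≡ ⟨
        length l                       ∎)
        where open ≤-Reasoning

    closed-trail : ∀ {a l} → Trail a a l → length l < g → l ≡ []
    closed-trail {l = []}    _ _   = refl
    closed-trail {l = _ ∷ _} t l<g with short-trail-is-path t l<g
    ... | a∉l ∷ _ = ⊥-elim (All¬⇒¬Any a∉l (end-∈ t))

    -- Trails leaving a in different directions towards the same vertex glue to
    -- a closed trail; if their total length is below the girth, both are empty.
    apart-trails : ∀ {a b p q} → Trail a b p → Trail a b q → Apart p q → length p + length q < g → p ≡ q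
    apart-trails {a} {p = p} {q} tp tq ap lt
      with flipOnto-empty a p q (closed-trail (glue tp tq ap) (subst (_< g) (≡.sym (length-flipOnto a p q)) lt))
    ... | refl , refl = refl

    trail-unique : ∀ {a b p q} → Trail a b p → Trail a b q → length p + length q < g → p ≡ q
    trail-unique {p = []}    tp tq lt = apart-trails tp tq tt lt
    trail-unique {p = c ∷ _} {q} tp tq lt with freshView c q
    ... | fresh f = apart-trails tp tq f lt
    ... | same _  = cong (c ∷_) (trail-unique (trail-tail tp) (trail-tail tq)
                      (≤-trans (s≤s (+-monoʳ-≤ _ (n≤1+n _))) (≤-trans (n≤1+n _) lt)))

  neighbour? : ∀ b u → Dec (Adj H b u)
  neighbour? b u = T? (adj H b u)

  module Continuation (no-leaf : ∀ v → degree H v ≢ 1) where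

    count-only-neighbour : ∀ {a b} l → Unique l → a ∈ l → Adj H b a → (∀ t → Adj H b t → t ≡ a) →
                           length (filter (neighbour? b) l) ≡ 1
    count-only-neighbour {b = b} (_ ∷ l) (a∉l ∷ _) (here refl) ba only =
      trans (cong length (filter-accept (neighbour? b) ba))
            (cong (λ l → suc (length l)) (filter-none (neighbour? b) (All.map (λ a≢t bt → a≢t (≡.sym (only _ bt))) a∉l)))
    count-only-neighbour {b = b} (c ∷ l) (c∉l ∷ uniq) (there a∈l) ba only =
      trans (cong length (filter-reject (neighbour? b) (λ bc → All¬⇒¬Any c∉l (subst (_∈ l) (≡.sym (only c bc)) a∈l))))
            (count-only-neighbour l uniq a∈l ba only)

    other-neighbour : ∀ {b a} → Adj H b a → Σ V λ t → Adj H b t × t ≢ a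
    other-neighbour {b} {a} ba with any? (λ t → neighbour? b t ×-dec ¬? (t ≟ᶠ a))
    ... | yes (t , bt , t≢a) = t , bt , t≢a
    ... | no none = ⊥-elim (no-leaf b (count-only-neighbour (allFin n) (allFin⁺ n) (∈-allFin a) ba only))
      where
      only : ∀ t → Adj H b t → t ≡ a
      only t bt = decidable-stable (t ≟ᶠ a) (λ t≢a → none (t , bt , t≢a))

    continue : ∀ (e : ℕ) {a p} → Adj H a p →
               Σ V λ u → Σ (List V) λ E → Trail a u E × length E ≡ e × Fresh p E
    continue zero    _  = _ , [] , stop , refl , tt
    continue (suc e) ap with other-neighbour ap
    ... | t , at , t≢p with continue e (adj-sym at)
    ...   | u , E , tE , |E| , fE = u , t ∷ E , go at fE tE , cong suc |E| , ≢-sym t≢p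

    follow : ∀ (e k : ℕ) {a p s γ} → Adj H a p → Trail a s γ → Fresh p γ → length γ ≤ k → e ≤ k →
             Σ V λ u → Σ (List V) λ E → Trail a u E × length E ≡ e × Fresh p E × DistLe H k s u
    follow e k ap stop _ _ e≤k with continue e ap
    ... | u , E , tE , |E| , fE = u , E , tE , |E| , fE , dist-mono (≤-trans (≤-reflexive |E|) e≤k) (trail-dist tE)
    follow zero k _ tγ _ γ≤k _ = _ , [] , stop , refl , tt , dist-mono γ≤k (dist-sym (trail-dist tγ))
    follow (suc e) (suc k) _ (go ac fγ tγ) p≢c (s≤s γ≤k) (s≤s e≤k) with follow e k (adj-sym ac) tγ fγ γ≤k e≤k
    ... | u , E , tE , |E| , fE , su = u , _ ∷ E , go ac fE tE , cong suc |E| , p≢c , dist-mono (n≤1+n k) su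

-- In a graph of girth at least 2r+3, trails of length at most r+1 are unique,
-- so the end of a trail of length r+1 is outside the r-ball of its start.
module Balls {n : ℕ} (H : Graph n) (r : ℕ) (girth : GirthAtLeast H (2 * r + 3)) where
  open Walks H
  open Girth (2 * r + 3) girth
  open Construction H r

  short-trails-equal : ∀ {a b p q} → Trail a b p → Trail a b q → length p ≤ suc r → length q ≤ suc r → p ≡ q
  short-trails-equal tp tq p≤ q≤ = trail-unique tp tq (≤-trans (s≤s (+-mono-≤ p≤ q≤)) (≤-reflexive (sum-bound r)))
    where
    sum-bound : ∀ r → suc (suc r + suc r) ≡ 2 * r + 3
    sum-bound = solve-∀

  far : ∀ {a b l} → Trail a b l → length l ≡ suc r → ¬ DistLe H r a b
  far t |l| d with geodesic d
  ... | l′ , t′ , l′≤r = 1+n≰n (subst (_≤ r) (trans (cong length (short-trails-equal t′ t (m≤n⇒m≤1+n l′≤r) (≤-reflexive |l|))) |l|) l′≤r)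

  ball : ∀ {a b} → DistLe H r a b → B a b
  ball {a} {b} d with a ≟ᶠ b
  ... | yes a≡b = inj₂ (≡.sym a≡b)
  ... | no  a≢b = inj₁ (a≢b , d)

  ball-dist : ∀ {a b} → B a b → DistLe H r a b
  ball-dist (inj₁ (_ , d)) = d
  ball-dist (inj₂ refl)    = 0 , z≤n , here

module Theorem {n : ℕ} (H : Graph n) (r : ℕ) (2≤r : 2 ≤ r) (girth : GirthAtLeast H (2 * r + 3))
               (no-leaf : ∀ v → degree H v ≢ 1) (x y : Fin n) (xy : Adj H x y) where
  open Walks H
  open Continuation no-leaf
  open Balls H r girth
  open Construction H r

  1≤r : 1 ≤ r
  1≤r = ≤-trans (s≤s z≤n) 2≤r

  yx : Adj H y x
  yx = adj-sym xy

  neighbour-in-balls : ∀ {z} → Adj H x z → B x z × B y z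
  neighbour-in-balls xz = ball (dist-mono 1≤r (dist-edge xz)) , ball (dist-mono 2≤r (dist-trans (dist-edge yx) (dist-edge xz)))

  through : ∀ {c u} → Adj H x c → DistLe H r c u → ¬ B x u → Σ (List (Fin n)) λ β → Trail x u (c ∷ β) × length β ≤ r
  through xc cu x∉u with geodesic cu
  ... | β , tβ , β≤r with freshView x β
  ...   | fresh f = β , go xc f tβ , β≤r
  ...   | same _  = ⊥-elim (x∉u (ball (dist-mono (≤-trans (n≤1+n _) β≤r) (trail-dist (trail-tail tβ)))))

  -- Every neighbour w ≠ y of x lies in S_{x,y}: a vertex of B_w ∩ B_y outside
  -- B_x would be reached from x by two different short trails.
  neighbour-in-S : ∀ {w} → Adj H x w → w ≢ y → S x y w
  neighbour-in-S {w} xw w≢y = (proj₁ (neighbour-in-balls xw) , proj₂ (neighbour-in-balls xw) , no-escape) , ≢-sym (adj-irrefl xw)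
    where
    no-escape : ¬ (∃ λ u → B y u × ¬ B x u × B u w)
    no-escape (u , yu , x∉u , uw) with through xy (ball-dist yu) x∉u | through xw (dist-sym (ball-dist uw)) x∉u
    ... | β , tβ , β≤r | ζ , tζ , ζ≤r = w≢y (≡.sym (∷-injectiveˡ (short-trails-equal tβ tζ (s≤s β≤r) (s≤s ζ≤r))))

  -- Escaping from the trail q → y → x: if a trail γ from q towards s leaves the
  -- trail q ⋯ y x (p ∷ P) in another direction, walking along γ from q, and
  -- onwards if γ ends early, until r+1 steps from x gives a vertex u of
  -- B_y \ B_x that is within r of s.
  escape : ∀ {q s p P ρ γ} → Trail q y ρ → Trail q x (p ∷ P) → length P ≡ length ρ → length ρ < r →
           Trail q s γ → length γ ≤ r → Fresh p γ → ∃ λ u → B y u × ¬ B x u × B u s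
  escape {q} {p = p} {P} {ρ} tρ tτ@(go qp _ _) |P| ρ<r tγ γ≤r fγ
    with follow (r ∸ length ρ) r qp tγ fγ γ≤r (m∸n≤m r (length ρ))
  ... | u , E , tE , |E| , fE , su = u , ball yu , x∉u , ball (dist-sym su)
    where
    ρ+E : length ρ + length E ≡ r
    ρ+E = trans (cong (length ρ +_) |E|) (m+[n∸m]≡n (<⇒≤ ρ<r))
    yu : DistLe H r y u
    yu = subst (λ k → DistLe H k y u) ρ+E (dist-trans (dist-sym (trail-dist tρ)) (trail-dist tE))
    x∉u : ¬ B x u
    x∉u xu = far (glue tτ tE fE) length-r+1 (ball-dist xu)
      where
      length-r+1 : length (flipOnto q (p ∷ P) E) ≡ suc r
      length-r+1 = trans (length-flipOnto q (p ∷ P) E) (cong suc (trans (cong (_+ length E) |P|) ρ+E))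

  -- If a trail γ from q to s ≠ x is at most as long as the trail q ⋯ y x, then
  -- B_y \ B_x meets B_s: the two trails agree for a while, and where they
  -- separate (γ cannot run all the way to x) there is an escape.
  descend : ∀ {q s ρ γ} → Trail q y ρ → Trail q x (ρ ∷ʳ x) → length ρ < r →
            Trail q s γ → length γ ≤ suc (length ρ) → s ≢ x → ∃ λ u → B y u × ¬ B x u × B u s
  descend {ρ = []} {γ} tρ tτ ρ<r tγ γ≤ s≢x with freshView x γ
  ... | fresh f = escape tρ tτ refl ρ<r tγ (≤-trans γ≤ ρ<r) f
  descend {ρ = []} tρ tτ ρ<r (go _ _ stop) γ≤ s≢x | same [] = ⊥-elim (s≢x refl)
  descend {ρ = []} tρ tτ ρ<r tγ (s≤s ()) s≢x | same (_ ∷ _)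
  descend {ρ = c ∷ ρ′} {γ} tρ tτ ρ<r tγ γ≤ s≢x with freshView c γ
  ... | fresh f = escape tρ tτ (trans (length-++ ρ′) (+-comm _ 1)) ρ<r tγ (≤-trans γ≤ ρ<r) f
  ... | same _  = descend (trail-tail tρ) (trail-tail tτ) (≤-trans (n≤1+n _) ρ<r) (trail-tail tγ) (≤-pred γ≤) s≢x

  beyond-y : ∀ {v s β} → Trail x v (y ∷ β) → suc (length β) ≡ r → S x y s → ¬ B s v
  beyond-y {v} {β = β} (go _ x∉β tβ) |yβ| ((_ , _ , no-escape) , s≢x) sv with geodesic (dist-sym (ball-dist sv))
  ... | γ , tγ , γ≤r = no-escape (descend tρ tτ (≤-reflexive ρ+1) tγ (≤-trans γ≤r (≤-reflexive (≡.sym ρ+1))) s≢x)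
    where
    ρ : List (Fin n)
    ρ = flipOnto y β []
    tρ : Trail v y ρ
    tρ = glue tβ stop (apart-nil β)
    tτ : Trail v x (ρ ∷ʳ x)
    tτ = subst (Trail v x) (flipOnto-++ y β [] [ x ]) (glue tβ (go yx tt stop) (apart-cons β x∉β))
    ρ+1 : suc (length ρ) ≡ r
    ρ+1 = trans (cong suc (trans (length-flipOnto y β []) (+-identityʳ _))) |yβ|

  -- Every neighbour z of x belongs to N_{x,y}: a vertex v of P_{x,y} at
  -- distance r from x would lie behind y (otherwise v ∉ B_y) and hence in no
  -- ball around a vertex of S_{x,y}.
  neighbour-in-N : ∀ {z} → Adj H x z → N x y z
  neighbour-in-N {z} xz = (proj₁ (neighbour-in-balls xz) , proj₂ (neighbour-in-balls xz) , near-z) , ≢-sym (adj-irrefl xz)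
    where
    near-z : ∀ v → P x y v → B v z
    near-z v (xv , yv , s , s∈S , sv) with geodesic (ball-dist xv)
    ... | α , tα , α≤r with suc (length α) ≤? r
    ...   | yes α<r = ball (dist-mono (≤-trans (≤-reflexive (+-comm (length α) 1)) α<r)
                                      (dist-trans (dist-sym (trail-dist tα)) (dist-edge xz)))
    ...   | no  α≮r = ⊥-elim (v-at-distance-r (≤-antisym α≤r (≤-pred (≰⇒> α≮r))))
      where
      v-at-distance-r : length α ≡ r → ⊥
      v-at-distance-r |α| with freshView y α
      ... | fresh f = far (go yx f tα) (cong suc |α|) (ball-dist yv)
      ... | same _  = beyond-y tα |α| s∈S sv

  -- With a neighbour w ≠ y of
  -- x in S_{x,y}, each vertex within r-1 of x is in P_{x,y}, so its ball
  -- contains z; if z were at distance ≥ 2 from x, a trail from z through x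
  -- continued to total length r+1 would end at such a vertex.
  N-neighbour : ∀ {z} → N x y z → Adj H x z
  N-neighbour ((xz , _ , near-z) , z≢x) with other-neighbour xy | geodesic (ball-dist xz)
  ... | _ , _ , _ | [] , stop , _ = ⊥-elim (z≢x refl)
  ... | _ , _ , _ | _ ∷ [] , go xc _ stop , _ = xc
  ... | w , xw , w≢y | α@(_ ∷ _ ∷ _) , tα@(go xc _ _) , α≤r with continue (suc r ∸ length α) xc
  ...   | u , E , tE , |E| , fE = ⊥-elim (far (glue tα tE fE) length-r+1 (dist-sym (ball-dist (near-z u (in-P (dist-mono E≤r-1 (trail-dist tE)))))))
    where
    E≤r-1 : length E ≤ r ∸ 1
    E≤r-1 = ≤-trans (≤-reflexive |E|) (∸-monoʳ-≤ (suc r) (s≤s (s≤s z≤n)))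
    length-r+1 : length (flipOnto x α E) ≡ suc r
    length-r+1 = trans (length-flipOnto x α E) (trans (cong (length α +_) |E|) (m+[n∸m]≡n (m≤n⇒m≤1+n α≤r)))
    in-P : ∀ {u} → DistLe H (r ∸ 1) x u → P x y u
    in-P d = ball (dist-mono (m∸n≤m r 1) d)
           , ball (dist-mono 1+[r-1] (dist-trans (dist-edge yx) d))
           , w , neighbour-in-S xw w≢y
           , ball (dist-mono 1+[r-1] (dist-trans (dist-edge (adj-sym xw)) d))
      where
      1+[r-1] : 1 + (r ∸ 1) ≤ r
      1+[r-1] = ≤-reflexive (m+[n∸m]≡n 1≤r)

theorem4 : (n r : ℕ) → 2 ≤ r → (H : Graph n) → Connected H
    → (∀ v → degree H v ≢ 1) → GirthAtLeast H (2 * r + 3)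
    → (x y : Fin n) → Adj H x y
    → ∀ z → Construction.N H r x y z ⇔ Adj H x z
theorem4 n r 2≤r H _ no-leaf girth x y xy z = mk⇔ N-neighbour neighbour-in-N
  where open Theorem H r 2≤r girth no-leaf x y xy
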